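{- Let $k,n$ be positive integers and $G\subseteq S_k$ a subgroup. The graded poset $B_{\mathbf{1}_G}(k,n)$ is rank-symmetric, i.e. for each $r$ the number of elements of rank $r$ equals the number of elements of rank $k(n-1)-r$.
   Context: $S_k$ acts on $[n]^k$ by $w(x)=(x_{w^{ -1}(1)},\dots,x_{w^{ -1}(k)})$. For $x\in[n]^k$, $\overline x$ is the lexicographic minimum of $\{g(x):g\in G\}$; $B_{\mathbf{1}_G}(k,n)=\{\overline x:x\in[n]^k\}$, ordered by $x\preccurlyeq y$ iff $x\leqslant g(y)$ componentwise for some $g\in G$; it is graded with rank function $\rho(x)=\sum_{i=1}^k(x_i-1)$. -}

module Defs where

open import Data.Nat using (ℕ; zero; suc; _+_; _≡ᵇ_)
open import Data.Bool using (Bool; true; false; if_then_else_)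
open import Data.Fin using (Fin; toℕ)
open import Data.Fin.Properties using () renaming (_≟_ to _≟F_)
open import Data.Fin.Permutation using (Permutation′; _≈_; id; flip; _∘ₚ_; _⟨$⟩ʳ_; _⟨$⟩ˡ_)
open import Data.Vec using (Vec; []; _∷_; lookup; tabulate)
open import Data.Vec.Properties using (≡-dec)
open import Data.List using (List; []; _∷_; map; concatMap; foldr; length; filter; deduplicate)
open import Data.List.Relation.Unary.Any using (Any)
open import Data.List.Relation.Unary.All using (All)
open import Data.List.Membership.Propositional using (_∈_)
open import Relation.Nullary.Decidable using (Dec)
open import Relation.Binary.PropositionalEquality using (_≡_)
open import Data.Nat.Properties using () renaming (_≟_ to _≟ℕ_)

record IsSubgroup {k : ℕ} (G : List (Permutation′ k)) : Set where
  field
    has-id  : Any (λ g → g ≈ id) G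
    closed  : ∀ {g h} → g ∈ G → h ∈ G → Any (λ f → f ≈ (g ∘ₚ h)) G
    inverse : ∀ {g} → g ∈ G → Any (λ f → f ≈ flip g) G

-- [n]^k, with [n] = {1,…,n} modelled by Fin n (value i ↔ i+1).
Tuple : ℕ → ℕ → Set
Tuple k n = Vec (Fin n) k

allTuples : (k n : ℕ) → List (Tuple k n)
allTuples zero    n = [] ∷ []
allTuples (suc k) n = concatMap (λ i → map (i ∷_) (allTuples k n)) (Data.List.allFin n)
  where import Data.List

act : ∀ {k n} → Permutation′ k → Tuple k n → Tuple k n
act w x = tabulate (λ i → lookup x (w ⟨$⟩ˡ i))

lexLeq : ∀ {k n} → Tuple k n → Tuple k n → Bool
lexLeq []       []       = true
lexLeq (a ∷ xs) (b ∷ ys) with toℕ a Data.Nat.<ᵇ toℕ b | toℕ a ≡ᵇ toℕ b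
  where import Data.Nat
... | true  | _     = true
... | false | true  = lexLeq xs ys
... | false | false = false

lexMin : ∀ {k n} → Tuple k n → Tuple k n → Tuple k n
lexMin x y = if lexLeq x y then x else y

-- x̄ = lexicographic minimum of the orbit {g(x) : g ∈ G}
-- (x itself is used as the fold seed; it lies in the orbit since id ∈ G)
canon : ∀ {k n} → List (Permutation′ k) → Tuple k n → Tuple k n
canon G x = foldr lexMin x (map (λ g → act g x) G)

B : (k n : ℕ) → List (Permutation′ k) → List (Tuple k n)
B k n G = deduplicate (≡-dec _≟F_) (map (canon G) (allTuples k n))

-- rank ρ(x) = Σ (x_i − 1); with 0-based Fin this is Σ toℕ x_i
rank : ∀ {k n} → Tuple k n → ℕ
rank []       = 0
rank (a ∷ xs) = toℕ a + rank xs

rankCount : (k n : ℕ) → List (Permutation′ k) → ℕ → ℕ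
rankCount k n G r = length (filter (λ x → rank x ≟ℕ r) (B k n G))

-- Complementation x ↦ (n+1−x₁, …, n+1−xₖ) commutes with the action of S_k and sends rank ρ
-- to k(n−1)−ρ. Hence y ↦ (canonical form of the complement of y) is an involution of
-- B_{1_G}(k,n) exchanging the elements of rank r with those of rank k(n−1)−r.
module Submission where

open import Defs
open import Data.Nat using (ℕ; _*_; _∸_; _≤_; NonZero)
open import Data.List using (List)
open import Data.Fin.Permutation using (Permutation′)
open import Relation.Binary.PropositionalEquality using (_≡_)

open import Data.Nat using (zero; suc; _+_; _<ᵇ_; _≡ᵇ_)
import Data.Nat.Properties as ℕ
open import Data.Bool using (true; false)
open import Data.Unit using (tt)
open import Data.Product using (_×_; _,_; ∃-syntax)
open import Data.Sum using (_⊎_; inj₁; inj₂; [_,_]′)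
open import Data.Fin using (Fin; toℕ; opposite)
import Data.Fin.Properties as Fin
open import Data.Fin.Permutation using (_≈_; id; flip; _∘ₚ_; _⟨$⟩ʳ_; _⟨$⟩ˡ_; inverseˡ; inverseʳ)
open import Data.Vec using ([]; _∷_; lookup)
import Data.Vec as Vec
open import Data.Vec.Properties using (≡-dec; lookup∘tabulate; tabulate∘lookup; tabulate-cong; lookup-map; map-∘; map-id; map-cong; tabulate-∘)
open import Data.Vec.Relation.Binary.Lex.Core using (base; this; next)
open import Data.Vec.Relation.Binary.Lex.Strict using (Lex-≤; ≤-totalOrder)
open import Data.Vec.Relation.Binary.Pointwise.Inductive using (Pointwise-≡⇒≡; ≡⇒Pointwise-≡)
open import Data.List using ([]; _∷_; map; foldr; length; filter)
open import Data.List.Relation.Unary.Any as Any using (here; there)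
import Data.List.Relation.Unary.All as All
import Data.List.Relation.Unary.All.Properties as AllP
open import Data.List.Properties using (foldr-preservesᵒ; length-map)
open import Data.List.Membership.Propositional using (_∈_; find)
open import Data.List.Membership.Propositional.Properties
  using (∈-map⁺; ∈-map⁻; ∈-concatMap⁺; ∈-allFin; ∈-filter⁺; ∈-filter⁻; ∈-deduplicate⁺; ∈-deduplicate⁻; foldr-selective)
open import Data.List.Membership.Propositional.Properties.WithK using (unique∧set⇒bag)
open import Data.List.Relation.Binary.Subset.Propositional using (_⊆_)
open import Data.List.Relation.Binary.BagAndSetEquality using (∼bag⇒↭)
open import Data.List.Relation.Binary.Permutation.Propositional.Properties using (↭-length)
open import Data.List.Relation.Unary.Unique.Propositional using (Unique; []; _∷_)
import Data.List.Relation.Unary.Unique.Propositional.Properties as Unique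
import Data.List.Relation.Unary.Unique.DecPropositional.Properties as UniqueDec
open import Relation.Binary.Bundles using (TotalOrder)
open import Algebra.Definitions using (Selective)
open import Relation.Binary.PropositionalEquality using (refl; sym; trans; cong; cong₂; subst; module ≡-Reasoning)
open import Relation.Nullary using (¬_; contradiction)
open import Relation.Nullary.Reflects using (Reflects; ofʸ; ofⁿ; fromEquivalence)
open import Function using (_∘_; mk⇔)
open import Algebra.Properties.CommutativeMonoid.Sum ℕ.+-0-commutativeMonoid using (sum; sum-cong-≗; sum-permute)
open import Algebra.Properties.CommutativeSemigroup ℕ.+-commutativeSemigroup using (interchange)

_≤ₗ_ : ∀ {k n} → Tuple k n → Tuple k n → Set
_≤ₗ_ = Lex-≤ _≡_ Data.Fin._<_

module LexOrder {k n : ℕ} = TotalOrder (≤-totalOrder (Fin.<-strictTotalOrder n) k)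

≤ₗ-antisym : ∀ {k n} {x y : Tuple k n} → x ≤ₗ y → y ≤ₗ x → x ≡ y
≤ₗ-antisym x≤y y≤x = Pointwise-≡⇒≡ (LexOrder.antisym x≤y y≤x)

≤ₗ-refl : ∀ {k n} {x : Tuple k n} → x ≤ₗ x
≤ₗ-refl = LexOrder.reflexive (≡⇒Pointwise-≡ refl)

lexLeq-reflects : ∀ {k n} (x y : Tuple k n) → Reflects (x ≤ₗ y) (lexLeq x y)
lexLeq-reflects [] [] = ofʸ (base tt)
lexLeq-reflects (a ∷ xs) (b ∷ ys)
  with toℕ a <ᵇ toℕ b | ℕ.<ᵇ-reflects-< (toℕ a) (toℕ b)
     | toℕ a ≡ᵇ toℕ b | fromEquivalence (ℕ.≡ᵇ⇒≡ (toℕ a) (toℕ b)) (ℕ.≡⇒≡ᵇ (toℕ a) (toℕ b))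
... | true  | ofʸ a<b | _     | _       = ofʸ (this a<b refl)
... | false | ofⁿ a≮b | false | ofⁿ a≢b = ofⁿ λ { (this a<b _) → a≮b a<b ; (next refl _) → a≢b refl }
... | false | ofⁿ a≮b | true  | ofʸ a≡b with lexLeq xs ys | lexLeq-reflects xs ys
...   | true  | ofʸ xs≤ys = ofʸ (next (Fin.toℕ-injective a≡b) xs≤ys)
...   | false | ofⁿ xs≰ys = ofⁿ λ { (this a<b _) → a≮b a<b ; (next _ xs≤ys) → xs≰ys xs≤ys }

≰ₗ⇒≥ₗ : ∀ {k n} {x y : Tuple k n} → ¬ x ≤ₗ y → y ≤ₗ x
≰ₗ⇒≥ₗ {x = x} {y} x≰y with LexOrder.total x y
... | inj₁ x≤y = contradiction x≤y x≰y
... | inj₂ y≤x = y≤x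

module _ {k n : ℕ} where

  lexMin-≤ˡ : (x y : Tuple k n) → lexMin x y ≤ₗ x
  lexMin-≤ˡ x y with lexLeq x y | lexLeq-reflects x y
  ... | true  | ofʸ _   = ≤ₗ-refl
  ... | false | ofⁿ x≰y = ≰ₗ⇒≥ₗ x≰y

  lexMin-≤ʳ : (x y : Tuple k n) → lexMin x y ≤ₗ y
  lexMin-≤ʳ x y with lexLeq x y | lexLeq-reflects x y
  ... | true  | ofʸ x≤y = x≤y
  ... | false | ofⁿ _   = ≤ₗ-refl

  lexMin-sel : Selective _≡_ (lexMin {k} {n})
  lexMin-sel x y with lexLeq x y
  ... | true  = inj₁ refl
  ... | false = inj₂ refl

  foldr-lexMin-∈ : (e : Tuple k n) (xs : List (Tuple k n)) → foldr lexMin e xs ∈ e ∷ xs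
  foldr-lexMin-∈ e xs = [ here , there ]′ (foldr-selective lexMin-sel e xs)

  foldr-lexMin-≤ : ∀ {z} (e : Tuple k n) (xs : List (Tuple k n)) → z ∈ e ∷ xs → foldr lexMin e xs ≤ₗ z
  foldr-lexMin-≤ {z} e xs z∈e∷xs = foldr-preservesᵒ {P = _≤ₗ z} lexMin-≤ e xs (split z∈e∷xs)
    where
      lexMin-≤ : ∀ x y → x ≤ₗ z ⊎ y ≤ₗ z → lexMin x y ≤ₗ z
      lexMin-≤ x y (inj₁ x≤z) = LexOrder.trans (lexMin-≤ˡ x y) x≤z
      lexMin-≤ x y (inj₂ y≤z) = LexOrder.trans (lexMin-≤ʳ x y) y≤z
      split : z ∈ e ∷ xs → e ≤ₗ z ⊎ Any.Any (_≤ₗ z) xs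
      split (here refl) = inj₁ ≤ₗ-refl
      split (there z∈xs) = inj₂ (Any.map (λ { refl → ≤ₗ-refl }) z∈xs)

module _ {k n : ℕ} where

  lookup-act : (g : Permutation′ k) (x : Tuple k n) (i : Fin k) → lookup (act g x) i ≡ lookup x (g ⟨$⟩ˡ i)
  lookup-act g x = lookup∘tabulate (lookup x ∘ (g ⟨$⟩ˡ_))

  act-cong : {f g : Permutation′ k} → f ≈ g → (x : Tuple k n) → act f x ≡ act g x
  act-cong {f} {g} f≈g x = tabulate-cong (cong (lookup x) ∘ f≈g⇒fˡ≡gˡ)
    where
      open ≡-Reasoning
      f≈g⇒fˡ≡gˡ : ∀ i → f ⟨$⟩ˡ i ≡ g ⟨$⟩ˡ i
      f≈g⇒fˡ≡gˡ i = begin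
        f ⟨$⟩ˡ i                     ≡⟨ cong (f ⟨$⟩ˡ_) (inverseʳ g) ⟨
        f ⟨$⟩ˡ (g ⟨$⟩ʳ (g ⟨$⟩ˡ i))   ≡⟨ cong (f ⟨$⟩ˡ_) (f≈g (g ⟨$⟩ˡ i)) ⟨
        f ⟨$⟩ˡ (f ⟨$⟩ʳ (g ⟨$⟩ˡ i))   ≡⟨ inverseˡ f ⟩
        g ⟨$⟩ˡ i                     ∎

  act-id : (x : Tuple k n) → act id x ≡ x
  act-id = tabulate∘lookup

  act-∘ₚ : (g h : Permutation′ k) (x : Tuple k n) → act g (act h x) ≡ act (h ∘ₚ g) x
  act-∘ₚ g h x = tabulate-cong (lookup-act h x ∘ (g ⟨$⟩ˡ_))

  act-flip : (h : Permutation′ k) (x : Tuple k n) → act (flip h) (act h x) ≡ x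
  act-flip h x = trans (tabulate-cong λ i → trans (lookup-act h x (h ⟨$⟩ʳ i)) (cong (lookup x) (inverseˡ h)))
                       (tabulate∘lookup x)

  complement : Tuple k n → Tuple k n
  complement = Vec.map opposite

  complement-involutive : (x : Tuple k n) → complement (complement x) ≡ x
  complement-involutive x = trans (sym (map-∘ opposite opposite x))
                                  (trans (map-cong Fin.opposite-involutive x) (map-id x))

  act-complement : (g : Permutation′ k) (x : Tuple k n) → act g (complement x) ≡ complement (act g x)
  act-complement g x = trans (tabulate-cong λ i → lookup-map (g ⟨$⟩ˡ i) opposite x)
                             (tabulate-∘ opposite (lookup x ∘ (g ⟨$⟩ˡ_)))

rank≡sum : ∀ {k n} (x : Tuple k n) → rank x ≡ sum (toℕ ∘ lookup x)
rank≡sum []      = refl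
rank≡sum (a ∷ x) = cong (toℕ a +_) (rank≡sum x)

rank-act : ∀ {k n} (g : Permutation′ k) (x : Tuple k n) → rank (act g x) ≡ rank x
rank-act g x = begin
  rank (act g x)                     ≡⟨ rank≡sum (act g x) ⟩
  sum (toℕ ∘ lookup (act g x))       ≡⟨ sum-cong-≗ (cong toℕ ∘ lookup-act g x) ⟩
  sum (toℕ ∘ lookup x ∘ (g ⟨$⟩ˡ_))   ≡⟨ sum-permute (toℕ ∘ lookup x) (flip g) ⟨
  sum (toℕ ∘ lookup x)               ≡⟨ rank≡sum x ⟨
  rank x                             ∎
  where open ≡-Reasoning

toℕ-opposite+toℕ : ∀ {n} (a : Fin n) → toℕ (opposite a) + toℕ a ≡ n ∸ 1
toℕ-opposite+toℕ {n} a = begin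
  toℕ (opposite a) + toℕ a   ≡⟨ cong (_+ toℕ a) (Fin.opposite-prop a) ⟩
  n ∸ suc (toℕ a) + toℕ a    ≡⟨ cong (_+ toℕ a) (ℕ.∸-+-assoc n 1 (toℕ a)) ⟨
  n ∸ 1 ∸ toℕ a + toℕ a      ≡⟨ ℕ.m∸n+n≡m (ℕ.∸-monoˡ-≤ 1 (Fin.toℕ<n a)) ⟩
  n ∸ 1                      ∎
  where open ≡-Reasoning

rank-complement : ∀ {k n} (x : Tuple k n) → rank (complement x) + rank x ≡ k * (n ∸ 1)
rank-complement []      = refl
rank-complement (a ∷ x) =
  trans (interchange (toℕ (opposite a)) (rank (complement x)) (toℕ a) (rank x))
        (cong₂ _+_ (toℕ-opposite+toℕ a) (rank-complement x))

∈-allTuples : ∀ k n (x : Tuple k n) → x ∈ allTuples k n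
∈-allTuples zero    n []      = here refl
∈-allTuples (suc k) n (a ∷ x) =
  ∈-concatMap⁺ (λ i → map (i ∷_) (allTuples k n))
               (Any.map (λ { refl → ∈-map⁺ (a ∷_) (∈-allTuples k n x) }) (∈-allFin a))

module Canonical {k n : ℕ} {G : List (Permutation′ k)} (G-subgroup : IsSubgroup G) where
  open IsSubgroup G-subgroup

  orbit : Tuple k n → List (Tuple k n)
  orbit x = map (λ g → act g x) G

  act∈orbit : ∀ {g} (x : Tuple k n) → g ∈ G → act g x ∈ orbit x
  act∈orbit x = ∈-map⁺ (λ g → act g x)

  ∈orbit⇒act : ∀ {z} (x : Tuple k n) → z ∈ orbit x → ∃[ g ] g ∈ G × z ≡ act g x
  ∈orbit⇒act x = ∈-map⁻ (λ g → act g x)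

  x∈orbit[x] : (x : Tuple k n) → x ∈ orbit x
  x∈orbit[x] x with find has-id
  ... | e , e∈G , e≈id = subst (_∈ orbit x) (trans (act-cong {f = e} {g = id} e≈id x) (act-id x)) (act∈orbit x e∈G)

  orbit-act⊆orbit : ∀ {h} (x : Tuple k n) → h ∈ G → orbit (act h x) ⊆ orbit x
  orbit-act⊆orbit {h} x h∈G z∈orbit with ∈orbit⇒act (act h x) z∈orbit
  ... | g , g∈G , refl with find (closed h∈G g∈G)
  ...   | f , f∈G , f≈h∘g =
    subst (_∈ orbit x) (trans (act-cong {f = f} {g = h ∘ₚ g} f≈h∘g x) (sym (act-∘ₚ g h x))) (act∈orbit x f∈G)

  orbit⊆orbit-act : ∀ {h} (x : Tuple k n) → h ∈ G → orbit x ⊆ orbit (act h x)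
  orbit⊆orbit-act {h} x h∈G {z} z∈orbit with find (inverse h∈G)
  ... | h⁻¹ , h⁻¹∈G , h⁻¹≈flip-h = orbit-act⊆orbit (act h x) h⁻¹∈G (subst (λ y → z ∈ orbit y) (sym x≡) z∈orbit)
    where
      x≡ : act h⁻¹ (act h x) ≡ x
      x≡ = trans (act-cong {f = h⁻¹} {g = flip h} h⁻¹≈flip-h (act h x)) (act-flip h x)

  canon∈orbit : (x : Tuple k n) → canon G x ∈ orbit x
  canon∈orbit x with foldr-lexMin-∈ x (orbit x)
  ... | here canon≡x = subst (_∈ orbit x) (sym canon≡x) (x∈orbit[x] x)
  ... | there canon∈ = canon∈

  canon-≤ₗ : ∀ {z} (x : Tuple k n) → z ∈ orbit x → canon G x ≤ₗ z
  canon-≤ₗ x z∈orbit = foldr-lexMin-≤ x (orbit x) (there z∈orbit)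

  canon-orbit-invariant : ∀ {x z : Tuple k n} → z ∈ orbit x → canon G z ≡ canon G x
  canon-orbit-invariant {x} z∈orbit with ∈orbit⇒act x z∈orbit
  ... | h , h∈G , refl = ≤ₗ-antisym
    (canon-≤ₗ (act h x) (orbit⊆orbit-act x h∈G (canon∈orbit x)))
    (canon-≤ₗ x (orbit-act⊆orbit x h∈G (canon∈orbit (act h x))))

  rank-canon : (x : Tuple k n) → rank (canon G x) ≡ rank x
  rank-canon x with ∈orbit⇒act x (canon∈orbit x)
  ... | g , _ , canon≡gx = trans (cong rank canon≡gx) (rank-act g x)

  canon∈B : (x : Tuple k n) → canon G x ∈ B k n G
  canon∈B x = ∈-deduplicate⁺ (≡-dec Fin._≟_) (∈-map⁺ (canon G) (∈-allTuples k n x))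

  ∈B⇒canonical : ∀ {y : Tuple k n} → y ∈ B k n G → canon G y ≡ y
  ∈B⇒canonical y∈B with ∈-map⁻ (canon G) (∈-deduplicate⁻ (≡-dec Fin._≟_) _ y∈B)
  ... | x , _ , refl = canon-orbit-invariant (canon∈orbit x)

  dual : Tuple k n → Tuple k n
  dual y = canon G (complement y)

  complement-dual∈orbit : (y : Tuple k n) → complement (dual y) ∈ orbit y
  complement-dual∈orbit y with ∈orbit⇒act (complement y) (canon∈orbit (complement y))
  ... | g , g∈G , dual≡ = subst (_∈ orbit y) (sym complement-dual≡) (act∈orbit y g∈G)
    where
      open ≡-Reasoning
      complement-dual≡ : complement (dual y) ≡ act g y
      complement-dual≡ = begin
        complement (dual y)                        ≡⟨ cong complement dual≡ ⟩
        complement (act g (complement y))          ≡⟨ cong complement (act-complement g y) ⟩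
        complement (complement (act g y))          ≡⟨ complement-involutive (act g y) ⟩
        act g y                                    ∎

  dual-involutive : ∀ {y : Tuple k n} → y ∈ B k n G → dual (dual y) ≡ y
  dual-involutive {y} y∈B = trans (canon-orbit-invariant (complement-dual∈orbit y)) (∈B⇒canonical y∈B)

  rank-dual : (y : Tuple k n) → rank (dual y) ≡ k * (n ∸ 1) ∸ rank y
  rank-dual y = begin
    rank (dual y)                               ≡⟨ rank-canon (complement y) ⟩
    rank (complement y)                         ≡⟨ ℕ.m+n∸n≡m (rank (complement y)) (rank y) ⟨
    rank (complement y) + rank y ∸ rank y       ≡⟨ cong (_∸ rank y) (rank-complement y) ⟩
    k * (n ∸ 1) ∸ rank y                        ∎
    where open ≡-Reasoning

  level : ℕ → List (Tuple k n)
  level r = filter (λ y → rank y ℕ.≟ r) (B k n G)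

  ∈level⁻ : ∀ {r y} → y ∈ level r → y ∈ B k n G × rank y ≡ r
  ∈level⁻ {r} = ∈-filter⁻ (λ y → rank y ℕ.≟ r)

  unique-level : (r : ℕ) → Unique (level r)
  unique-level r = Unique.filter⁺ (λ y → rank y ℕ.≟ r) (UniqueDec.deduplicate-! (≡-dec Fin._≟_) (map (canon G) (allTuples k n)))

  dual∈level : ∀ {r y} → y ∈ level r → dual y ∈ level (k * (n ∸ 1) ∸ r)
  dual∈level {r} {y} y∈level with ∈level⁻ y∈level
  ... | _ , refl = ∈-filter⁺ (λ y → rank y ℕ.≟ k * (n ∸ 1) ∸ r) (canon∈B (complement y)) (rank-dual y)

  dual-involutive-on-level : ∀ {r y} → y ∈ level r → dual (dual y) ≡ y
  dual-involutive-on-level y∈level with ∈level⁻ y∈level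
  ... | y∈B , _ = dual-involutive y∈B

unique-map⁺ : ∀ {A B : Set} {f : A → B} {xs : List A} → Unique xs →
              (∀ {x y} → x ∈ xs → y ∈ xs → f x ≡ f y → x ≡ y) → Unique (map f xs)
unique-map⁺ []             _   = []
unique-map⁺ (x∉xs ∷ xs!) inj =
  AllP.map⁺ (All.tabulate λ y∈xs fx≡fy → All.lookup x∉xs y∈xs (inj (here refl) (there y∈xs) fx≡fy))
  ∷ unique-map⁺ xs! (λ x∈xs y∈xs → inj (there x∈xs) (there y∈xs))

length-≡-by-inverses : ∀ {A B : Set} {xs : List A} {ys : List B} (f : A → B) (g : B → A) →
  Unique xs → Unique ys → (∀ {x} → x ∈ xs → f x ∈ ys) → (∀ {y} → y ∈ ys → g y ∈ xs) →
  (∀ {x} → x ∈ xs → g (f x) ≡ x) → (∀ {y} → y ∈ ys → f (g y) ≡ y) →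
  length xs ≡ length ys
length-≡-by-inverses {xs = xs} {ys} f g xs! ys! f-into g-into gf≡id fg≡id =
  trans (sym (length-map f xs)) (↭-length (∼bag⇒↭ (unique∧set⇒bag f[xs]! ys! (mk⇔ to from))))
  where
    f[xs]! : Unique (map f xs)
    f[xs]! = unique-map⁺ xs! λ x∈xs y∈xs fx≡fy →
      trans (sym (gf≡id x∈xs)) (trans (cong g fx≡fy) (gf≡id y∈xs))
    to : ∀ {z} → z ∈ map f xs → z ∈ ys
    to z∈f[xs] with ∈-map⁻ f z∈f[xs]
    ... | x , x∈xs , refl = f-into x∈xs
    from : ∀ {z} → z ∈ ys → z ∈ map f xs
    from z∈ys = subst (_∈ map f xs) (fg≡id z∈ys) (∈-map⁺ f (g-into z∈ys))

corollary5p9 : (k n : ℕ) → .{{NonZero k}} → .{{NonZero n}} →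
    (G : List (Permutation′ k)) → IsSubgroup G →
    (r : ℕ) → r ≤ k * (n ∸ 1) →
    rankCount k n G r ≡ rankCount k n G (k * (n ∸ 1) ∸ r)
corollary5p9 k n G G-subgroup r r≤N =
  length-≡-by-inverses dual dual (unique-level r) (unique-level (N ∸ r))
    dual∈level dual∈level′ dual-involutive-on-level dual-involutive-on-level
  where
    open Canonical {k} {n} G-subgroup
    N = k * (n ∸ 1)
    dual∈level′ : ∀ {y} → y ∈ level (N ∸ r) → dual y ∈ level r
    dual∈level′ y∈level = subst (λ s → _ ∈ level s) (ℕ.m∸[m∸n]≡n r≤N) (dual∈level y∈level)
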